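{- For every frame $\mathcal{F}=\langle S,R\rangle$ and distinct propositional variables $p,q,r$: $\mathcal{F}\vDash \bullet q\land\Delta p\land\circ(\neg q\to p)\to\circ(\neg q\to\circ(\neg r\to p))$ if and only if $R$ is transitive.
   Context: Fix a nonempty set $\mathbf{P}$ of propositional variables. $\mathcal{L}(\nabla,\bullet)$: $\varphi::=p\mid\neg\varphi\mid\varphi\land\varphi\mid\nabla\varphi\mid\bullet\varphi$ ($p\in\mathbf{P}$), with $\Delta\varphi:=\neg\nabla\varphi$ and $\circ\varphi:=\neg\bullet\varphi$. A frame is $\mathcal{F}=\langle S,R\rangle$ with $S$ nonempty and $R\subseteq S\times S$; a model on $\mathcal{F}$ adds a valuation $V:\mathbf{P}\to\mathcal{P}(S)$. Truth: $\mathcal{M},s\vDash p$ iff $s\in V(p)$; Booleans as usual; $\mathcal{M},s\vDash\nabla\varphi$ iff there are $t,u$ with $sRt$, $sRu$, $\mathcal{M},t\vDash\varphi$, $\mathcal{M},u\nvDash\varphi$; $\mathcal{M},s\vDash\bullet\varphi$ iff $\mathcal{M},s\vDash\varphi$ and some $t$ with $sRt$ has $\mathcal{M},t\nvDash\varphi$. $\mathcal{F}\vDash\varphi$ means $\varphi$ is true at every state of every model based on $\mathcal{F}$. -}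

module Defs where

open import Data.Product using (_×_; Σ-syntax)
open import Data.Empty using (⊥)
open import Relation.Nullary using (¬_)

data Form (P : Set) : Set where
  var  : P → Form P
  ¬'_  : Form P → Form P
  _∧'_ : Form P → Form P → Form P
  ∇_   : Form P → Form P
  •_   : Form P → Form P

infixr 6 _∧'_

module _ {P : Set} where
  Δ_ : Form P → Form P
  Δ φ = ¬' (∇ φ)

  ∘_ : Form P → Form P
  ∘ φ = ¬' (• φ)

  infixr 5 _→'_
  _→'_ : Form P → Form P → Form P
  φ →' ψ = ¬' (φ ∧' ¬' ψ)

-- Frames: nonempty carrier (witnessed by a point) and a relation.
record Frame : Set₁ where
  field
    S     : Set
    point : S
    R     : S → S → Set

record Model (P : Set) : Set₁ where
  field
    frame : Frame
  open Frame frame public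
  field
    V : P → S → Set

module _ {P : Set} where
  _,_⊨_ : (M : Model P) → Model.S M → Form P → Set
  M , s ⊨ var p = Model.V M p s
  M , s ⊨ (¬' φ) = ¬ (M , s ⊨ φ)
  M , s ⊨ (φ ∧' ψ) = (M , s ⊨ φ) × (M , s ⊨ ψ)
  M , s ⊨ (∇ φ) = Σ[ t ∈ Model.S M ] Σ[ u ∈ Model.S M ]
                    (Model.R M s t × Model.R M s u × (M , t ⊨ φ) × ¬ (M , u ⊨ φ))
  M , s ⊨ (• φ) = (M , s ⊨ φ) × (Σ[ t ∈ Model.S M ] (Model.R M s t × ¬ (M , t ⊨ φ)))

_⊨F_ : {P : Set} → Frame → Form P → Set₁
_⊨F_ {P} F φ = (V : P → Frame.S F → Set) → (s : Frame.S F) →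
               record { frame = F ; V = V } , s ⊨ φ

Transitive : Frame → Set
Transitive F = ∀ {x y z} → R x y → R y z → R x z
  where open Frame F

module Submission where

-- Under the antecedent at s, q holds at s and fails at some successor t₀, so ¬q → p holds
-- at s vacuously; ∘(¬q → p) then propagates it to t₀, forcing p there, and Δp spreads p to
-- every successor of s. The consequent fails at s exactly when p fails two R-steps away,
-- which transitivity turns into a successor of s. Conversely, for x R y R z without x R z,
-- let p hold at the successors of x, q only at x and r nowhere: the antecedent holds at x,
-- while y and z refute the consequent.

open import Defs
open import Level using (0ℓ; Lift; suc; lift)
open import Axiom.ExcludedMiddle using (ExcludedMiddle)
open import Relation.Binary.PropositionalEquality using (_≢_; _≡_; refl; sym)
open import Relation.Nullary using (¬_)
open import Relation.Nullary.Decidable using (decidable-stable)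
open import Function.Bundles using (_⇔_; mk⇔)
open import Data.Product using (_×_; _,_; Σ-syntax)
open import Data.Sum using (_⊎_; inj₁; inj₂)

module _ {P : Set} (M : Model P) where
  open Model M

  →'-vacuous : ∀ {s} φ ψ → ¬ (M , s ⊨ φ) → M , s ⊨ (φ →' ψ)
  →'-vacuous _ _ ¬φ (φ , _) = ¬φ φ

  →'-trivial : ∀ {s} φ ψ → M , s ⊨ ψ → M , s ⊨ (φ →' ψ)
  →'-trivial _ _ ψ (_ , ¬ψ) = ¬ψ ψ

  →'-mp : ∀ {s} φ ψ → M , s ⊨ (φ →' ψ) → M , s ⊨ φ → ¬ ¬ (M , s ⊨ ψ)
  →'-mp _ _ φ→ψ φ ¬ψ = φ→ψ (φ , ¬ψ)

  ∘-intro : ∀ {s} φ → (∀ {t} → R s t → M , t ⊨ φ) → M , s ⊨ (∘ φ)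
  ∘-intro _ succ⊨φ (_ , _ , sRt , ¬φ) = ¬φ (succ⊨φ sRt)

  ∘-elim : ∀ {s t} φ → M , s ⊨ (∘ φ) → M , s ⊨ φ → R s t → ¬ ¬ (M , t ⊨ φ)
  ∘-elim _ ∘φ φ sRt ¬φ = ∘φ (φ , _ , sRt , ¬φ)

  Δ-intro : ∀ {s} φ → (∀ {t} → R s t → M , t ⊨ φ) → M , s ⊨ (Δ φ)
  Δ-intro _ succ⊨φ (_ , _ , _ , sRu , _ , ¬φ) = ¬φ (succ⊨φ sRu)

  Δ-elim : ∀ {s t u} φ → M , s ⊨ (Δ φ) → R s t → R s u → M , t ⊨ φ → ¬ ¬ (M , u ⊨ φ)
  Δ-elim _ Δφ sRt sRu φt ¬φu = Δφ (_ , _ , sRt , sRu , φt , ¬φu)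

module _ {P : Set} (p q r : P) where

  antecedent : Form P
  antecedent = (• var q) ∧' (Δ var p) ∧' (∘ ((¬' var q) →' var p))

  consequent : Form P
  consequent = ∘ ((¬' var q) →' (∘ ((¬' var r) →' var p)))

  module _ (M : Model P) where
    open Model M

    antecedent⇒successors⊨p : ∀ {s u} → M , s ⊨ antecedent → R s u → ¬ ¬ (M , u ⊨ var p)
    antecedent⇒successors⊨p {s} ((qs , t₀ , sRt₀ , ¬qt₀) , Δp , ∘[¬q→p]) sRu ¬pu =
      ∘-elim M ((¬' var q) →' var p) ∘[¬q→p] [¬q→p]s sRt₀ λ [¬q→p]t₀ →
      →'-mp M (¬' var q) (var p) [¬q→p]t₀ ¬qt₀ λ pt₀ →
      Δ-elim M (var p) Δp sRt₀ sRu pt₀ ¬pu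
      where
      [¬q→p]s : M , s ⊨ ((¬' var q) →' var p)
      [¬q→p]s = →'-vacuous M (¬' var q) (var p) (λ ¬qs → ¬qs qs)

    ¬consequent⇒two-step-¬p : ∀ {s} → ¬ (M , s ⊨ consequent) →
      ¬ ¬ (Σ[ t ∈ S ] Σ[ u ∈ S ] (R s t × R t u × ¬ (M , u ⊨ var p)))
    ¬consequent⇒two-step-¬p ¬∘X ¬two-step =
      ¬∘X λ { (_ , t , sRt , ¬Xt) → ¬Xt λ { (_ , ¬∘Y) → ¬∘Y λ { (_ , u , tRu , ¬Yu) →
        ¬Yu λ { (_ , ¬pu) → ¬two-step (t , u , sRt , tRu , ¬pu) } } } }

transitive⇒valid : {P : Set} (F : Frame) (p q r : P) →
  Transitive F → F ⊨F (antecedent p q r →' consequent p q r)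
transitive⇒valid F p q r trans V s (ante , ¬conseq) =
  ¬consequent⇒two-step-¬p p q r M ¬conseq λ { (_ , _ , sRt , tRu , ¬pu) →
    antecedent⇒successors⊨p p q r M ante (trans sRt tRu) ¬pu }
  where M = record { frame = F ; V = V }

module Countermodel {P : Set} (F : Frame) {p q r : P} (p≢q : p ≢ q) (p≢r : p ≢ r) (q≢r : q ≢ r)
  {x y z : Frame.S F} (xRy : Frame.R F x y) (yRz : Frame.R F y z) (¬xRz : ¬ Frame.R F x z) where
  open Frame F

  V : P → S → Set
  V a w = (a ≡ p × R x w) ⊎ (a ≡ q × w ≡ x)

  M : Model P
  M = record { frame = F ; V = V }

  successors⊨p : ∀ {w} → R x w → M , w ⊨ var p
  successors⊨p xRw = inj₁ (refl , xRw)

  x⊨q : M , x ⊨ var q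
  x⊨q = inj₂ (refl , refl)

  y⊭q : ¬ (M , y ⊨ var q)
  y⊭q (inj₁ (q≡p , _)) = p≢q (sym q≡p)
  y⊭q (inj₂ (_ , refl)) = ¬xRz yRz

  z⊭p : ¬ (M , z ⊨ var p)
  z⊭p (inj₁ (_ , xRz)) = ¬xRz xRz
  z⊭p (inj₂ (p≡q , _)) = p≢q p≡q

  z⊭r : ¬ (M , z ⊨ var r)
  z⊭r (inj₁ (r≡p , _)) = p≢r (sym r≡p)
  z⊭r (inj₂ (r≡q , _)) = q≢r (sym r≡q)

  x⊨antecedent : M , x ⊨ antecedent p q r
  x⊨antecedent = (x⊨q , y , xRy , y⊭q)
               , Δ-intro M (var p) successors⊨p
               , ∘-intro M ((¬' var q) →' var p)
                   (λ xRw → →'-trivial M (¬' var q) (var p) (successors⊨p xRw))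

  x⊭consequent : ¬ (M , x ⊨ consequent p q r)
  x⊭consequent x⊨∘X = x⊨∘X
    ( →'-vacuous M (¬' var q) (∘ ((¬' var r) →' var p)) (λ ¬qx → ¬qx x⊨q) , y , xRy
    , λ y⊨X → y⊨X (y⊭q , λ y⊨∘Y → y⊨∘Y
        ( →'-trivial M (¬' var r) (var p) (successors⊨p xRy) , z , yRz
        , λ z⊨Y → z⊨Y (z⊭r , z⊭p))))

valid⇒transitive : {P : Set} → ExcludedMiddle 0ℓ → (F : Frame) {p q r : P} →
  p ≢ q → p ≢ r → q ≢ r → F ⊨F (antecedent p q r →' consequent p q r) → Transitive F
valid⇒transitive lem F p≢q p≢r q≢r valid {x} xRy yRz =
  decidable-stable lem λ ¬xRz →
    let open Countermodel F p≢q p≢r q≢r xRy yRz ¬xRz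
    in valid V x (x⊨antecedent , x⊭consequent)

mainTheorem5 : ExcludedMiddle 0ℓ → (P : Set) → (F : Frame) → (p q r : P) →
    p ≢ q → p ≢ r → q ≢ r →
    (F ⊨F ((• var q) ∧' (Δ var p) ∧' (∘ ((¬' var q) →' var p)) →'
    ∘ ((¬' var q) →' (∘ ((¬' var r) →' var p)))))
    ⇔ Lift (suc 0ℓ) (Transitive F)
mainTheorem5 lem P F p q r p≢q p≢r q≢r = mk⇔
  (λ valid → lift λ {x y z} → valid⇒transitive lem F p≢q p≢r q≢r valid)
  (λ trans → transitive⇒valid F p q r (Lift.lower trans))
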